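{- If a digraph $D$ has a strongly connected bipartite spanning subdigraph, then $\overrightarrow{pc}(D)\le 2$.
   Context: All digraphs are finite, loopless, without parallel arcs (opposite arcs are allowed). A digraph is bipartite if its vertex set can be partitioned into two independent sets. A digraph is strongly connected if for every ordered pair $(u,v)$ of vertices there is a directed $uv$-path. A directed path in an arc-coloured digraph is properly coloured if no two consecutive arcs on it have the same colour. An arc-colouring of $D$ makes $D$ properly connected if for every ordered pair $(u,v)$ of distinct vertices there is a properly coloured directed $uv$-path; $\overrightarrow{pc}(D)$ is the minimum number of colours in such an arc-colouring. -}

module Defs where

open import Data.Nat using (ℕ)
open import Data.Fin using (Fin)
open import Data.Bool using (Bool; true; false)
open import Data.List using (List; []; _∷_)
open import Data.List.Relation.Unary.Unique.Propositional using (Unique)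
open import Data.Product using (Σ; _×_; ∃; ∃-syntax)
open import Data.Unit using (⊤)
open import Relation.Binary.PropositionalEquality using (_≡_; _≢_)

-- A finite digraph on vertex set Fin n.  Arcs are given by a Boolean
-- adjacency function (so no parallel arcs; opposite arcs allowed);
-- loops are excluded.
record Digraph : Set where
  field
    n        : ℕ
    arc      : Fin n → Fin n → Bool
    loopless : ∀ v → arc v v ≡ false
open Digraph public

IsSpanningSub : (D : Digraph) → (Fin (n D) → Fin (n D) → Bool) → Set
IsSpanningSub D H = ∀ u v → H u v ≡ true → arc D u v ≡ true

Chain : {m : ℕ} → (Fin m → Fin m → Bool) → Fin m → List (Fin m) → Set
Chain A x []       = ⊤
Chain A x (y ∷ ys) = (A x y ≡ true) × Chain A y ys

endOf : {m : ℕ} → Fin m → List (Fin m) → Fin m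
endOf x []       = x
endOf x (y ∷ ys) = endOf y ys

IsPath : {m : ℕ} → (Fin m → Fin m → Bool) → Fin m → Fin m → List (Fin m) → Set
IsPath A u v ys = Chain A u ys × (endOf u ys ≡ v) × Unique (u ∷ ys)

StronglyConnected : {m : ℕ} → (Fin m → Fin m → Bool) → Set
StronglyConnected {m} A = ∀ (u v : Fin m) → ∃[ ys ] IsPath A u v ys

Bipartite : {m : ℕ} → (Fin m → Fin m → Bool) → Set
Bipartite {m} A = Σ (Fin m → Bool) λ side → ∀ (u v : Fin m) → A u v ≡ true → side u ≢ side v

-- Arc-colourings with k colours (the value on non-arcs is irrelevant).
ArcColouring : Digraph → ℕ → Set
ArcColouring D k = Fin (n D) → Fin (n D) → Fin k

ProperlyColoured : {m k : ℕ} → (Fin m → Fin m → Fin k) → Fin m → List (Fin m) → Set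
ProperlyColoured c x []            = ⊤
ProperlyColoured c x (y ∷ [])      = ⊤
ProperlyColoured c x (y ∷ z ∷ zs)  = (c x y ≢ c y z) × ProperlyColoured c y (z ∷ zs)

ProperlyConnected : (D : Digraph) {k : ℕ} → ArcColouring D k → Set
ProperlyConnected D c = ∀ (u v : Fin (n D)) → u ≢ v →
  ∃[ ys ] (IsPath (arc D) u v ys × ProperlyColoured c u ys)

pc≤ : Digraph → ℕ → Set
pc≤ D k = Σ (ArcColouring D k) (ProperlyConnected D)

-- Colour every arc by the side of the bipartition containing its tail. Along
-- any path of the bipartite subdigraph the tails alternate sides, so
-- consecutive arcs get different colours, and its strong connectivity supplies
-- such a path between any two vertices.
module Submission where

open import Defs
open import Data.Bool using (Bool; true; false)
open import Data.Fin using (Fin; zero; suc)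
open import Data.List using (List; []; _∷_)
open import Data.Product using (Σ; _×_; _,_)
open import Function using (_∘_)
open import Function.Definitions using (Injective)
open import Relation.Binary.PropositionalEquality using (_≡_; _≢_; refl)

Bool→Fin2 : Bool → Fin 2
Bool→Fin2 false = zero
Bool→Fin2 true  = suc zero

Bool→Fin2-injective : Injective _≡_ _≡_ Bool→Fin2
Bool→Fin2-injective {false} {false} _ = refl
Bool→Fin2-injective {true}  {true}  _ = refl

Chain-mono : ∀ {m} {A B : Fin m → Fin m → Bool} →
  (∀ u v → A u v ≡ true → B u v ≡ true) →
  ∀ x ys → Chain A x ys → Chain B x ys
Chain-mono A⊆B x []       _         = _
Chain-mono A⊆B x (y ∷ ys) (xy , ch) = A⊆B x y xy , Chain-mono A⊆B y ys ch

IsPath-mono : ∀ {m} {A B : Fin m → Fin m → Bool} →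
  (∀ u v → A u v ≡ true → B u v ≡ true) →
  ∀ {u v} ys → IsPath A u v ys → IsPath B u v ys
IsPath-mono A⊆B ys (ch , end , unique) = Chain-mono A⊆B _ ys ch , end , unique

Chain⇒ProperlyColoured : ∀ {m k} {A : Fin m → Fin m → Bool} (c : Fin m → Fin m → Fin k) →
  (∀ x y z → A x y ≡ true → A y z ≡ true → c x y ≢ c y z) →
  ∀ x ys → Chain A x ys → ProperlyColoured c x ys
Chain⇒ProperlyColoured c sep x []           _                = _
Chain⇒ProperlyColoured c sep x (y ∷ [])     _                = _
Chain⇒ProperlyColoured c sep x (y ∷ z ∷ zs) (xy , yz , ch) =
  sep x y z xy yz , Chain⇒ProperlyColoured c sep y (z ∷ zs) (yz , ch)

tailColouring : ∀ {m} → (Fin m → Bool) → Fin m → Fin m → Fin 2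
tailColouring side x _ = Bool→Fin2 (side x)

tailColouring-separates : ∀ {m} {A : Fin m → Fin m → Bool} (side : Fin m → Bool) →
  (∀ u v → A u v ≡ true → side u ≢ side v) →
  ∀ x y z → A x y ≡ true → A y z ≡ true → tailColouring side x y ≢ tailColouring side y z
tailColouring-separates side independent x y z xy _ =
  independent x y xy ∘ Bool→Fin2-injective

corollary1 : (D : Digraph) →
    Σ (Fin (n D) → Fin (n D) → Bool)
      (λ H → IsSpanningSub D H × StronglyConnected H × Bipartite H) →
    pc≤ D 2
corollary1 D (H , H⊆D , strong , (side , independent)) = c , connected
  where
  c : ArcColouring D 2
  c = tailColouring side

  connected : ProperlyConnected D c
  connected u v _ with strong u v
  ... | ys , path@(ch , _) =
    ys , IsPath-mono H⊆D ys path ,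
    Chain⇒ProperlyColoured c (tailColouring-separates side independent) u ys ch
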